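{- Let $(W,S)$ be a Coxeter system, let $w\in W$ be faux CFC, and let $s,t\in S$ be distinct with $m(s,t)\ge 3$ odd. Then no torically reduced word $\mathsf{u}\in\mathcal{R}_{\mathrm{tor}}(w)$ contains $\langle s,t\rangle_{m(s,t)}$ as a (consecutive) subword.
   Context: $(W,S)$ is a Coxeter system with bond strengths $m(s,t)$ (order of $st$). For distinct $s,t$, $\langle s,t\rangle_k=stst\cdots$ ($k$ letters). A braid relation replaces a consecutive subword $\langle s,t\rangle_{m(s,t)}$ by $\langle t,s\rangle_{m(s,t)}$; short if $m(s,t)=2$. An element is fully commutative (FC) if all its reduced words are related by short braid relations; it is cyclically fully commutative (CFC) if for any reduced word of it, every cyclic shift is a reduced word of an FC element. The cyclic word $[\mathsf{w}]$ of a word is the set of its cyclic shifts; two cyclic words differ by a (short) braid if a representative of one is converted into a representative of the other by one (short) braid relation; $\approx$ (resp. $\sim$) is the generated equivalence. A word is torically reduced if it stays reduced under any sequence of cyclic shifts and/or braid relations; an element is torically reduced if its reduced words are. For torically reduced $w$ with reduced word $\mathsf{w}$: $\mathcal{R}_{\mathrm{tor}}([w])=\{[\mathsf{u}]:[\mathsf{u}]\approx[\mathsf{w}]\}$, $\mathcal{R}_{\mathrm{tor}}(w)=\{\mathsf{u}:[\mathsf{u}]\in\mathcal{R}_{\mathrm{tor}}([w])\}$. $w$ is torically fully commutative (TFC) if it is torically reduced and $\mathcal{R}_{\mathrm{tor}}([w])$ is a single $\sim$-class; $w$ is faux CFC if it is TFC but not CFC. -}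

module Defs where

open import Data.Nat using (ℕ; zero; suc; _≤_)
open import Data.Fin using (Fin)
open import Data.List using (List; []; _∷_; _++_; length)
open import Data.Product using (Σ; _×_; _,_; ∃-syntax)
open import Data.Sum using (_⊎_)
open import Relation.Nullary using (¬_)
open import Relation.Binary.PropositionalEquality using (_≡_; _≢_)
open import Relation.Binary.Construct.Closure.ReflexiveTransitive using (Star)
open import Relation.Binary.Construct.Closure.Equivalence using (EqClosure)

-- Coxeter matrix of rank n on S = Fin n.  The value 0 encodes m(s,t) = ∞.
record CoxeterMatrix (n : ℕ) : Set where
  field
    m     : Fin n → Fin n → ℕ
    diag  : ∀ s → m s s ≡ 1
    symm  : ∀ s t → m s t ≡ m t s
    off   : ∀ s t → s ≢ t → m s t ≢ 1

alt : ∀ {n} → Fin n → Fin n → ℕ → List (Fin n)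
alt s t zero    = []
alt s t (suc k) = s ∷ alt t s k

module Coxeter {n : ℕ} (M : CoxeterMatrix n) where
  open CoxeterMatrix M public

  Word : Set
  Word = List (Fin n)

  Braid : Word → Word → Set
  Braid u v = Σ Word λ x → Σ Word λ y → Σ (Fin n) λ s → Σ (Fin n) λ t →
    s ≢ t × m s t ≢ 0 ×
    u ≡ x ++ alt s t (m s t) ++ y × v ≡ x ++ alt t s (m s t) ++ y

  ShortBraid : Word → Word → Set
  ShortBraid u v = Σ Word λ x → Σ Word λ y → Σ (Fin n) λ s → Σ (Fin n) λ t →
    s ≢ t × m s t ≡ 2 ×
    u ≡ x ++ alt s t 2 ++ y × v ≡ x ++ alt t s 2 ++ y

  Cancel : Word → Word → Set
  Cancel u v = Σ Word λ x → Σ Word λ y → Σ (Fin n) λ s →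
    u ≡ x ++ s ∷ s ∷ y × v ≡ x ++ y

  -- equality in W = ⟨ S | s² = 1, braid relations ⟩ (monoid presentation
  -- of the Coxeter group): congruence generated by cancellations and braids
  EqW : Word → Word → Set
  EqW = EqClosure (λ u v → Cancel u v ⊎ Braid u v)

  Reduced : Word → Set
  Reduced u = ∀ v → EqW u v → length u ≤ length v

  Rot : Word → Word → Set
  Rot u v = Σ Word λ x → Σ Word λ y → u ≡ x ++ y × v ≡ y ++ x

  FC : Word → Set
  FC w₀ = ∀ v v' → EqW w₀ v → EqW w₀ v' → Reduced v → Reduced v' →
          Star ShortBraid v v'

  CFC : Word → Set
  CFC w₀ = ∀ v → EqW w₀ v → Reduced v → ∀ v' → Rot v v' → Reduced v' × FC v'

  TorRedWord : Word → Set
  TorRedWord u = ∀ v → Star (λ a b → Rot a b ⊎ Braid a b) u v → Reduced v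

  TorRed : Word → Set
  TorRed w₀ = ∀ v → EqW w₀ v → Reduced v → TorRedWord v

  -- cyclic words differing by one (short) braid relation, lifted to
  -- representatives: rotate, apply one (short) braid, rotate
  CycBraid : Word → Word → Set
  CycBraid u v = Σ Word λ u' → Σ Word λ v' → Rot u u' × Braid u' v' × Rot v' v

  CycShortBraid : Word → Word → Set
  CycShortBraid u v =
    Σ Word λ u' → Σ Word λ v' → Rot u u' × ShortBraid u' v' × Rot v' v

  -- [u] ≈ [v]  and  [u] ∼ [v]  (generated equivalences on cyclic words,
  -- read on representatives, so rotations are identified)
  CycApprox : Word → Word → Set
  CycApprox = EqClosure (λ u v → Rot u v ⊎ CycBraid u v)

  CycSim : Word → Word → Set
  CycSim = EqClosure (λ u v → Rot u v ⊎ CycShortBraid u v)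

  InRtor : Word → Word → Set
  InRtor 𝗐 u = CycApprox u 𝗐

  TFC : Word → Set
  TFC w₀ = TorRed w₀ × (∀ 𝗐 → EqW w₀ 𝗐 → Reduced 𝗐 →
             ∀ u u' → InRtor 𝗐 u → InRtor 𝗐 u' → CycSim u u')

  FauxCFC : Word → Set
  FauxCFC w₀ = TFC w₀ × ¬ CFC w₀

  Factor : Word → Word → Set
  Factor v u = Σ Word λ x → Σ Word λ y → u ≡ x ++ v ++ y

-- Rotations and commutations only permute the letters of a word, so two
-- words in the same ∼-class have the same number of occurrences of each
-- generator. For m(s,t) odd the braid ⟨s,t⟩ₘ ↦ ⟨t,s⟩ₘ changes the number
-- of s's by one, while keeping the cyclic word in R_tor(w). If w is TFC the
-- two words would have to be ∼-equivalent, which is impossible.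
module Submission where

open import Defs
open import Data.Nat using (ℕ; zero; suc; _+_; _*_; _/_; _≤_; _%_)
open import Data.Nat.Properties using (1+n≢n; +-suc)
open import Data.Nat.DivMod using (m≡m%n+[m/n]*n)
open import Data.Fin using (Fin; _≟_)
open import Data.List using (List; _∷_; []; _++_; length; filter)
open import Data.List.Properties using (filter-accept; filter-reject; filter-++; length-++; ++-identityʳ)
open import Data.List.Relation.Binary.Permutation.Propositional using (_↭_; ↭-refl; ↭-trans; swap; ↭-isEquivalence)
open import Data.List.Relation.Binary.Permutation.Propositional.Properties using (↭-length; filter-↭; ++-comm; ++⁺ˡ)
open import Data.Product using (_,_)
open import Data.Sum using (inj₁; inj₂)
open import Function using (_∘_)
open import Relation.Nullary using (¬_)
open import Relation.Binary.PropositionalEquality using (_≡_; _≢_; refl; sym; trans; cong; subst; ≢-sym; module ≡-Reasoning)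
open import Relation.Binary.Construct.Closure.Equivalence using (fold)
open import Relation.Binary.Construct.Closure.ReflexiveTransitive using (_◅_)
open import Relation.Binary.Construct.Closure.Symmetric using (bwd)

odd⇒≡1+2*half : ∀ m → m % 2 ≡ 1 → m ≡ suc (m / 2 * 2)
odd⇒≡1+2*half m m-odd = trans (m≡m%n+[m/n]*n m 2) (cong (_+ m / 2 * 2) m-odd)

module _ {n : ℕ} (s : Fin n) where

  occurrences : List (Fin n) → ℕ
  occurrences = length ∘ filter (_≟ s)

  occurrences-↭ : ∀ {u v} → u ↭ v → occurrences u ≡ occurrences v
  occurrences-↭ = ↭-length ∘ filter-↭ (_≟ s)

  occurrences-++ : ∀ u v → occurrences (u ++ v) ≡ occurrences u + occurrences v
  occurrences-++ u v = trans (cong length (filter-++ (_≟ s) u v)) (length-++ (filter (_≟ s) u))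

  occurrences-self-∷ : ∀ u → occurrences (s ∷ u) ≡ suc (occurrences u)
  occurrences-self-∷ u = cong length (filter-accept (_≟ s) refl)

  occurrences-other-∷ : ∀ {t} → t ≢ s → ∀ u → occurrences (t ∷ u) ≡ occurrences u
  occurrences-other-∷ t≢s u = cong length (filter-reject (_≟ s) t≢s)

  occurrences-infix-suc : ∀ x y {v v'} → occurrences v ≡ suc (occurrences v') →
    occurrences (x ++ v ++ y) ≡ suc (occurrences (x ++ v' ++ y))
  occurrences-infix-suc x y {v} {v'} eq = begin
    occurrences (x ++ v ++ y)                          ≡⟨ occurrences-++ x (v ++ y) ⟩
    occurrences x + occurrences (v ++ y)               ≡⟨ cong (occurrences x +_) (occurrences-++ v y) ⟩
    occurrences x + (occurrences v + occurrences y)    ≡⟨ cong (λ k → occurrences x + (k + occurrences y)) eq ⟩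
    occurrences x + suc (occurrences v' + occurrences y) ≡⟨ +-suc (occurrences x) _ ⟩
    suc (occurrences x + (occurrences v' + occurrences y)) ≡⟨ cong (λ k → suc (occurrences x + k)) (occurrences-++ v' y) ⟨
    suc (occurrences x + occurrences (v' ++ y))        ≡⟨ cong suc (occurrences-++ x (v' ++ y)) ⟨
    suc (occurrences (x ++ v' ++ y))                   ∎
    where open ≡-Reasoning

  module _ {t : Fin n} (t≢s : t ≢ s) where

    occurrences-alt-even : ∀ k → occurrences (alt s t (k * 2)) ≡ k
    occurrences-alt-even zero = refl
    occurrences-alt-even (suc k) =
      trans (occurrences-self-∷ (t ∷ alt s t (k * 2)))
            (cong suc (trans (occurrences-other-∷ t≢s _) (occurrences-alt-even k)))

    occurrences-alt-even′ : ∀ k → occurrences (alt t s (k * 2)) ≡ k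
    occurrences-alt-even′ zero = refl
    occurrences-alt-even′ (suc k) =
      trans (occurrences-other-∷ t≢s (s ∷ alt t s (k * 2)))
            (trans (occurrences-self-∷ _) (cong suc (occurrences-alt-even′ k)))

    occurrences-alt-odd : ∀ k →
      occurrences (alt s t (suc (k * 2))) ≡ suc (occurrences (alt t s (suc (k * 2))))
    occurrences-alt-odd k = begin
      occurrences (s ∷ alt t s (k * 2))        ≡⟨ occurrences-self-∷ _ ⟩
      suc (occurrences (alt t s (k * 2)))      ≡⟨ cong suc (occurrences-alt-even′ k) ⟩
      suc k                                    ≡⟨ cong suc (occurrences-alt-even k) ⟨
      suc (occurrences (alt s t (k * 2)))      ≡⟨ cong suc (occurrences-other-∷ t≢s _) ⟨
      suc (occurrences (t ∷ alt s t (k * 2)))  ∎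
      where open ≡-Reasoning

module _ {n : ℕ} (M : CoxeterMatrix n) where
  open Coxeter M

  rot-refl : ∀ u → Rot u u
  rot-refl u = [] , u , refl , sym (++-identityʳ u)

  rot⇒↭ : ∀ {u v} → Rot u v → u ↭ v
  rot⇒↭ (x , y , refl , refl) = ++-comm x y

  shortBraid⇒↭ : ∀ {u v} → ShortBraid u v → u ↭ v
  shortBraid⇒↭ (x , _ , p , q , _ , _ , refl , refl) = ++⁺ˡ x (swap p q ↭-refl)

  cycShortBraid⇒↭ : ∀ {u v} → CycShortBraid u v → u ↭ v
  cycShortBraid⇒↭ (_ , _ , r , b , r') =
    ↭-trans (rot⇒↭ r) (↭-trans (shortBraid⇒↭ b) (rot⇒↭ r'))

  cycSim⇒↭ : ∀ {u v} → CycSim u v → u ↭ v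
  cycSim⇒↭ = fold ↭-isEquivalence λ { (inj₁ r) → rot⇒↭ r ; (inj₂ b) → cycShortBraid⇒↭ b }

  inRtor-braid : ∀ {𝗐 u v} → InRtor 𝗐 u → Braid u v → InRtor 𝗐 v
  inRtor-braid {u = u} {v} u∈R b = bwd (inj₂ (u , v , rot-refl u , b , rot-refl v)) ◅ u∈R

  TFC-braid⇒↭ : ∀ {w₀} → TFC w₀ → ∀ {𝗐} → EqW w₀ 𝗐 → Reduced 𝗐 →
    ∀ {u v} → InRtor 𝗐 u → Braid u v → u ↭ v
  TFC-braid⇒↭ (_ , single-class) w₀≈𝗐 𝗐-red u∈R b =
    cycSim⇒↭ (single-class _ w₀≈𝗐 𝗐-red _ _ u∈R (inRtor-braid u∈R b))

mainTheorem6 : ∀ {n} (M : CoxeterMatrix n) (w₀ : Coxeter.Word M) →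
    Coxeter.FauxCFC M w₀ →
    (s t : Fin n) → s ≢ t → 3 ≤ CoxeterMatrix.m M s t →
    CoxeterMatrix.m M s t % 2 ≡ 1 →
    ∀ (𝗐 : Coxeter.Word M) → Coxeter.EqW M w₀ 𝗐 → Coxeter.Reduced M 𝗐 →
    ∀ (u : Coxeter.Word M) → Coxeter.InRtor M 𝗐 u →
    ¬ Coxeter.Factor M (alt s t (CoxeterMatrix.m M s t)) u
mainTheorem6 M w₀ (tfc , _) s t s≢t 3≤m m-odd 𝗐 w₀≈𝗐 𝗐-red u u∈R (x , y , refl) =
  1+n≢n (trans (sym s-count-drops) s-count-kept)
  where
  open CoxeterMatrix M using (m)
  m≢0 : m s t ≢ 0
  m≢0 m≡0 with () ← subst (3 ≤_) m≡0 3≤m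
  s-count-kept : occurrences s (x ++ alt s t (m s t) ++ y) ≡ occurrences s (x ++ alt t s (m s t) ++ y)
  s-count-kept = occurrences-↭ s (TFC-braid⇒↭ M tfc w₀≈𝗐 𝗐-red u∈R (x , y , s , t , s≢t , m≢0 , refl , refl))
  s-count-drops : occurrences s (x ++ alt s t (m s t) ++ y) ≡ suc (occurrences s (x ++ alt t s (m s t) ++ y))
  s-count-drops = occurrences-infix-suc s x y
    (subst (λ k → occurrences s (alt s t k) ≡ suc (occurrences s (alt t s k)))
           (sym (odd⇒≡1+2*half (m s t) m-odd))
           (occurrences-alt-odd s (≢-sym s≢t) (m s t / 2)))
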